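{- Let $T$ be any ABT and $t$ a vertex of $T$ with $\mathrm{dist}^{\beta}(t)<\infty$. Then $\mathrm{dist}^{\beta}(t)>\mathsf{hlevel}(e^*_T(t))$.
   Context: $G$ finite simple graph, $M$ a matching, $U$ the $M$-uncovered vertices. $G^+$: add vertex $f$ and for each $u\in U$ a vertex $w_u$ with edges $\{f,w_u\},\{w_u,u\}$; $M^+=M\cup\{\{w_u,u\}\}$. Alternating path: simple path in $G^+$ alternating between $M^+$ and non-$M^+$ edges. $\mathrm{dist}^\theta(v)$: minimum length of an alternating $f$–$v$ path of parity $\theta\in\{\mathrm{odd},\mathrm{even}\}$ ($\infty$ if none). $\mathrm{dist}^\alpha(v)$, $\mathrm{dist}^\beta(v)$: min and max of the two. $\rho(e)=\mathrm{odd}$ if $e\in M^+$, else even. $\mathsf{P}(u)$: vertices $u'$ such that some alternating $f$–$u$ path of length $\mathrm{dist}^\alpha(u)$ ends with $\{u',u\}$. An ABT is a tree $T$ rooted at $f$ on the vertices with $\mathrm{dist}^\alpha<\infty$ with each $u\ne f$ having parent in $\mathsf{P}(u)$; $T(t)$ is the subtree at $t$. An incoming edge of $T(t)$ is a non-tree edge with exactly one endpoint in $T(t)$. For $e=\{y,z\}$: $\mathsf{vlevel}(e)=\mathrm{dist}^{\rho(e)}(y)+\mathrm{dist}^{\rho(e)}(z)+1$, $\mathsf{hlevel}(e)=\max\{\mathrm{dist}^{\rho(e)}(y),\mathrm{dist}^{\rho(e)}(z)\}$; levels compared lexicographically by $(\mathsf{vlevel},\mathsf{hlevel})$. $e^*_T(t)$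 is a fixed minimum-level incoming edge of $T(t)$. -}

module Defs where

open import Data.Nat using (ℕ; zero; suc; _+_; _≤_; _<_; _∸_)
open import Data.Nat.Base using (_⊔_; _⊓_)
open import Data.Fin using (Fin)
open import Data.Fin.Properties using () renaming (_≟_ to _≟F_)
open import Data.Maybe using (Maybe; just; nothing)
open import Data.Bool using (Bool; true; false; T; _∧_)
open import Data.List using (List; []; _∷_; _++_; length; head; last)
open import Data.List.Relation.Unary.Linked using (Linked)
open import Data.List.Relation.Unary.Unique.Propositional using (Unique)
open import Data.Product using (Σ; ∃; _×_; _,_)
open import Data.Sum using (_⊎_)
open import Relation.Nullary using (¬_; does)
open import Relation.Binary.PropositionalEquality using (_≡_)

data ℕ∞ : Set where
  fin : ℕ → ℕ∞
  ∞   : ℕ∞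

infixl 6 _⊕_
_⊕_ : ℕ∞ → ℕ∞ → ℕ∞
fin a ⊕ fin b = fin (a + b)
_     ⊕ _     = ∞

max∞ : ℕ∞ → ℕ∞ → ℕ∞
max∞ (fin a) (fin b) = fin (a ⊔ b)
max∞ _       _       = ∞

min∞ : ℕ∞ → ℕ∞ → ℕ∞
min∞ (fin a) (fin b) = fin (a ⊓ b)
min∞ (fin a) ∞       = fin a
min∞ ∞       y       = y

data _≤∞_ : ℕ∞ → ℕ∞ → Set where
  fin≤fin : ∀ {a b} → a ≤ b → fin a ≤∞ fin b
  _≤∞∞    : ∀ x → x ≤∞ ∞

data _<∞_ : ℕ∞ → ℕ∞ → Set where
  fin<fin : ∀ {a b} → a < b → fin a <∞ fin b
  fin<∞   : ∀ {a} → fin a <∞ ∞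

IsFin : ℕ∞ → Set
IsFin x = ∃ λ k → x ≡ fin k

_≤lex_ : ℕ∞ × ℕ∞ → ℕ∞ × ℕ∞ → Set
(a , b) ≤lex (c , d) = a <∞ c ⊎ (a ≡ c × b ≤∞ d)

data Parity : Set where
  odd even : Parity

parityOf : ℕ → Parity
parityOf zero          = even
parityOf (suc zero)    = odd
parityOf (suc (suc k)) = parityOf k

record SimpleGraph (n : ℕ) : Set₁ where
  field
    Adj    : Fin n → Fin n → Set
    sym    : ∀ {a b} → Adj a b → Adj b a
    irrefl : ∀ {a} → ¬ Adj a a

record Matching {n : ℕ} (G : SimpleGraph n) : Set where
  open SimpleGraph G
  field
    mate     : Fin n → Maybe (Fin n)     -- mate a ≡ just b  iff  {a,b} ∈ M
    mate-sym : ∀ {a b} → mate a ≡ just b → mate b ≡ just a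
    mate-adj : ∀ {a b} → mate a ≡ just b → Adj a b

module Setup {n : ℕ} (G : SimpleGraph n) (M : Matching G) where
  open SimpleGraph G
  open Matching M

  Uncovered : Fin n → Set
  Uncovered u = mate u ≡ nothing

  -- vertices of G⁺: the new vertex f, the vertices w_u, and the original vertices.
  -- (w u is only attached to the graph when u is uncovered; for covered u it is
  --  an isolated dummy vertex that lies on no path from f.)
  data V⁺ : Set where
    f : V⁺
    w : Fin n → V⁺
    o : Fin n → V⁺

  data Adj⁺ : V⁺ → V⁺ → Set where
    f-w : ∀ {u} → Uncovered u → Adj⁺ f (w u)
    w-f : ∀ {u} → Uncovered u → Adj⁺ (w u) f
    w-o : ∀ {u} → Uncovered u → Adj⁺ (w u) (o u)
    o-w : ∀ {u} → Uncovered u → Adj⁺ (o u) (w u)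
    o-o : ∀ {a b} → Adj a b → Adj⁺ (o a) (o b)

  isUncovered : Fin n → Bool
  isUncovered u with mate u
  ... | nothing = true
  ... | just _  = false

  isMate : Fin n → Fin n → Bool
  isMate a b with mate a
  ... | nothing = false
  ... | just c  = does (c ≟F b)

  -- membership of the (ordered pair of the) edge {y,z} in M⁺ = M ∪ {{w_u,u}}
  isM⁺ : V⁺ → V⁺ → Bool
  isM⁺ (o a) (o b) = isMate a b
  isM⁺ (w u) (o v) = does (u ≟F v) ∧ isUncovered u
  isM⁺ (o v) (w u) = does (u ≟F v) ∧ isUncovered u
  isM⁺ _     _     = false

  M⁺ : V⁺ → V⁺ → Set
  M⁺ y z = T (isM⁺ y z)

  data Alternating : List V⁺ → Set where
    []  : Alternating []
    [-] : ∀ {x} → Alternating (x ∷ [])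
    [-,-] : ∀ {x y} → Alternating (x ∷ y ∷ [])
    step : ∀ {x y z zs} →
           (M⁺ x y → ¬ M⁺ y z) → (¬ M⁺ x y → M⁺ y z) →
           Alternating (y ∷ z ∷ zs) → Alternating (x ∷ y ∷ z ∷ zs)

  record AltPath (v : V⁺) : Set where
    field
      verts  : List V⁺
      start  : head verts ≡ just f
      end    : last verts ≡ just v
      linked : Linked Adj⁺ verts
      simple : Unique verts
      alt    : Alternating verts

    len : ℕ
    len = length verts ∸ 1

  open AltPath public

  HasAltPath : Parity → V⁺ → ℕ → Set
  HasAltPath θ v k = Σ (AltPath v) λ p → len p ≡ k × parityOf k ≡ θ

  data IsDistValue (θ : Parity) (v : V⁺) : ℕ∞ → Set where
    isMin : ∀ {k} → HasAltPath θ v k → (∀ k' → HasAltPath θ v k' → k ≤ k') →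
            IsDistValue θ v (fin k)
    none  : (∀ k → ¬ HasAltPath θ v k) → IsDistValue θ v ∞

  IsDist : (Parity → V⁺ → ℕ∞) → Set
  IsDist d = ∀ θ v → IsDistValue θ v (d θ v)

  module WithDist (d : Parity → V⁺ → ℕ∞) where

    distα : V⁺ → ℕ∞
    distα v = min∞ (d odd v) (d even v)

    distβ : V⁺ → ℕ∞
    distβ v = max∞ (d odd v) (d even v)

    InP : V⁺ → V⁺ → Set
    InP u' u = Σ (AltPath u) λ p → distα u ≡ fin (len p) ×
               ∃ λ pre → verts p ≡ pre ++ (u' ∷ u ∷ [])

    InTree : V⁺ → Set
    InTree v = IsFin (distα v)

    -- an ABT, given by its parent function (a tree rooted at f on the
    -- vertices with finite dist^α; the parent of every u ≠ f lies in P(u))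
    record ABT : Set where
      field
        parent    : V⁺ → V⁺
        parent-ok : ∀ u → InTree u → ¬ u ≡ f → InP (parent u) u

    ρ : V⁺ → V⁺ → Parity
    ρ y z with isM⁺ y z
    ... | true  = odd
    ... | false = even

    vlevel : V⁺ → V⁺ → ℕ∞
    vlevel y z = d (ρ y z) y ⊕ d (ρ y z) z ⊕ fin 1

    hlevel : V⁺ → V⁺ → ℕ∞
    hlevel y z = max∞ (d (ρ y z) y) (d (ρ y z) z)

    level : V⁺ → V⁺ → ℕ∞ × ℕ∞
    level y z = vlevel y z , hlevel y z

    module InABT (T : ABT) where
      open ABT T

      data Sub (t : V⁺) : V⁺ → Set where
        root : Sub t t
        down : ∀ {s} → InTree s → ¬ s ≡ f → Sub t (parent s) → Sub t s

      TreeEdge : V⁺ → V⁺ → Set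
      TreeEdge y z = (InTree y × ¬ y ≡ f × parent y ≡ z)
                   ⊎ (InTree z × ¬ z ≡ f × parent z ≡ y)

      Incoming : V⁺ → V⁺ → V⁺ → Set
      Incoming t y z = Adj⁺ y z × ¬ TreeEdge y z ×
                       ((Sub t y × ¬ Sub t z) ⊎ (¬ Sub t y × Sub t z))

      -- {y,z} is a minimum-level incoming edge of T(t) (a valid choice of e*_T(t))
      MinIncoming : V⁺ → V⁺ → V⁺ → Set
      MinIncoming t y z = Incoming t y z ×
                          (∀ y' z' → Incoming t y' z' → level y z ≤lex level y' z')

{-# OPTIONS --safe #-}
-- Let a < k be the two alternating distances of t (of opposite parities), realised by alternating
-- f–t paths Q and P. Along tree edges away from f, dist^α strictly increases, so every vertex of
-- T(t) has dist^α ≥ a, with equality only at t. Let {y,z} be the edge through which P enters T(t)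
-- for the last time. It is an incoming edge of T(t): as a tree edge it would be the edge into t,
-- whose parity is that of a, not of k. The prefix of P bounds dist^ρ(y) by the position i < k of y
-- on P, and Q followed by P backwards from t to z bounds dist^ρ(z) by a + k - i - 1 < k; hence
-- vlevel{y,z} ≤ a + k and hlevel{y,z} < k. By minimality, e* either has the same vlevel and a
-- smaller hlevel, or vlevel(e*) < a + k. In the latter case its endpoint inside T(t) has distance
-- ≥ a and the one outside has distance ≥ a - 1 (extending its path by e* reaches T(t)), which
-- forces both distances below k. Choosing the last entry of P into T(t) is classical, so the
-- argument runs in the double-negation monad; the conclusion is decidable.

module Submission where

open import Defs
open import Data.Nat using (ℕ; zero; suc; _+_; _∸_; _≤_; _<_; _⊔_; s≤s; z≤n)
open import Data.Nat.Properties
open import Data.Empty using (⊥-elim)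
open import Data.Bool using (Bool; true; false; T)
open import Data.Bool.Properties using (⇔→≡)
open import Data.Fin.Properties using () renaming (_≟_ to _≟F_)
open import Data.List using (List; []; _∷_; _++_; _∷ʳ_; [_]; length; head; last)
open import Data.List.Properties using (∷ʳ-++; length-++; length-++-sucʳ)
open import Data.List.Reverse using (Reverse; []; _∶_∶ʳ_; reverseView)
open import Data.List.Membership.Propositional using (_∈_; _∉_)
open import Data.List.Membership.Propositional.Properties using (∈-∃++; ∈-++⁻)
open import Data.List.Relation.Unary.All as All using (All; []; _∷_)
import Data.List.Relation.Unary.All.Properties as Allₚ
open import Data.List.Relation.Unary.AllPairs using ([]; _∷_)
open import Data.List.Relation.Unary.Any using (here; there)
open import Data.List.Relation.Unary.Linked as Linked using (Linked; []; [-]; _∷_)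
import Data.List.Relation.Unary.Linked.Properties as Linkedₚ
open import Data.List.Relation.Unary.Unique.Propositional using (Unique)
import Data.List.Relation.Unary.Unique.Propositional.Properties as Uniqueₚ
open import Data.Maybe using (just; nothing)
open import Data.Maybe.Properties using (just-injective)
open import Data.Maybe.Relation.Binary.Connected using (Connected; just)
open import Data.Product using (∃; ∃₂; _×_; _,_; proj₁; proj₂; swap)
open import Data.Sum using (_⊎_; inj₁; inj₂)
open import Effect.Monad using (RawMonad)
open import Function using (_∘_; case_of_; _⇔_; mk⇔; Equivalence)
open import Level using (0ℓ)
open import Relation.Binary using (Decidable)
open import Relation.Binary.Definitions using (tri<; tri≈; tri>)
open import Relation.Binary.PropositionalEquality
  using (_≡_; _≢_; refl; sym; trans; cong; cong₂; subst; subst₂; module ≡-Reasoning)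
open import Relation.Nullary using (¬_; Dec; yes; no)
open import Relation.Nullary.Decidable using (map′; ¬¬-excluded-middle; decidable-stable)
open import Relation.Nullary.Negation using (¬¬-Monad; ¬¬-map)

open RawMonad (¬¬-Monad {a = 0ℓ})

opposite : Parity → Parity
opposite odd  = even
opposite even = odd

opposite-involutive : ∀ θ → opposite (opposite θ) ≡ θ
opposite-involutive odd  = refl
opposite-involutive even = refl

opposite-≢ : ∀ θ → opposite θ ≢ θ
opposite-≢ odd  ()
opposite-≢ even ()

parityOf-suc : ∀ m → parityOf (suc m) ≡ opposite (parityOf m)
parityOf-suc zero          = refl
parityOf-suc (suc zero)    = refl
parityOf-suc (suc (suc m)) = parityOf-suc m

opposite-parityOf-suc : ∀ m → opposite (parityOf (suc m)) ≡ parityOf m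
opposite-parityOf-suc m = trans (cong opposite (parityOf-suc m)) (opposite-involutive (parityOf m))

parityᵇ : Bool → Parity
parityᵇ true  = odd
parityᵇ false = even

alternation⇒opposite : ∀ {b c} → (T b → ¬ T c) → (¬ T b → T c) →
                       parityᵇ c ≡ opposite (parityᵇ b)
alternation⇒opposite {true}  {true}  b⇒¬c _ = ⊥-elim (b⇒¬c _ _)
alternation⇒opposite {true}  {false} _ _    = refl
alternation⇒opposite {false} {true}  _ _    = refl
alternation⇒opposite {false} {false} _ ¬b⇒c = ⊥-elim (¬b⇒c λ ())

opposite⇒alternation : ∀ {b c} → parityᵇ c ≡ opposite (parityᵇ b) → (T b → ¬ T c) × (¬ T b → T c)
opposite⇒alternation {true}  {false} _ = (λ _ ()) , λ ¬b → ⊥-elim (¬b _)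
opposite⇒alternation {false} {true}  _ = (λ ()) , _
opposite⇒alternation {true}  {true}  ()
opposite⇒alternation {false} {false} ()

summands-< : ∀ {a k x y} → a ≤ x → a ≤ suc y → x + y + 1 < a + k → x < k × y < k
summands-< {a} {k} {x} {y} a≤x a≤1+y x+y+1<a+k = x<k , y<k
  where
  open ≤-Reasoning
  x+y+1≡x+[1+y] : x + y + 1 ≡ x + suc y
  x+y+1≡x+[1+y] = trans (+-comm (x + y) 1) (sym (+-suc x y))
  x<k : x < k
  x<k = +-cancelʳ-< a x k (begin-strict
    x + a      ≤⟨ +-monoʳ-≤ x a≤1+y ⟩
    x + suc y  ≡⟨ x+y+1≡x+[1+y] ⟨
    x + y + 1  <⟨ x+y+1<a+k ⟩
    a + k      ≡⟨ +-comm a k ⟩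
    k + a      ∎)
  y<k : y < k
  y<k = <-trans (n<1+n y) (+-cancelˡ-< a (suc y) k (begin-strict
    a + suc y  ≤⟨ +-monoˡ-≤ (suc y) a≤x ⟩
    x + suc y  ≡⟨ x+y+1≡x+[1+y] ⟨
    x + y + 1  <⟨ x+y+1<a+k ⟩
    a + k      ∎))

<-from-sum : ∀ {a k ℓ i} → ℓ + suc i ≡ a + k → a ≤ i → ℓ < k
<-from-sum {a} {k} {ℓ} {i} ℓ+1+i≡a+k a≤i = +-cancelʳ-≤ i (suc ℓ) k (begin
  suc ℓ + i  ≡⟨ +-suc ℓ i ⟨
  ℓ + suc i  ≡⟨ ℓ+1+i≡a+k ⟩
  a + k      ≤⟨ +-monoˡ-≤ k a≤i ⟩
  i + k      ≡⟨ +-comm i k ⟩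
  k + i      ∎)
  where open ≤-Reasoning

fin-injective : ∀ {m n} → fin m ≡ fin n → m ≡ n
fin-injective refl = refl

fin-≤∞⁻ : ∀ {m n} → fin m ≤∞ fin n → m ≤ n
fin-≤∞⁻ (fin≤fin m≤n) = m≤n

≤∞-<∞-trans : ∀ {x y z} → x ≤∞ y → y <∞ z → x <∞ z
≤∞-<∞-trans (fin≤fin x≤y) (fin<fin y<z) = fin<fin (≤-<-trans x≤y y<z)
≤∞-<∞-trans (fin≤fin _)   fin<∞         = fin<∞

<∞-≤∞-trans : ∀ {x y z} → x <∞ y → y ≤∞ z → x <∞ z
<∞-≤∞-trans (fin<fin x<y) (fin≤fin y≤z) = fin<fin (<-≤-trans x<y y≤z)
<∞-≤∞-trans (fin<fin _)   (_ ≤∞∞)       = fin<∞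
<∞-≤∞-trans fin<∞         (_ ≤∞∞)       = fin<∞

≤∞-trans : ∀ {x y z} → x ≤∞ y → y ≤∞ z → x ≤∞ z
≤∞-trans (fin≤fin x≤y) (fin≤fin y≤z) = fin≤fin (≤-trans x≤y y≤z)
≤∞-trans _             (_ ≤∞∞)       = _ ≤∞∞

⊕-mono-≤∞ : ∀ {x y m n} → x ≤∞ fin m → y ≤∞ fin n → (x ⊕ y) ≤∞ fin (m + n)
⊕-mono-≤∞ (fin≤fin x≤m) (fin≤fin y≤n) = fin≤fin (+-mono-≤ x≤m y≤n)

⊕-⊕-1-<∞-fin⁻ : ∀ {x y m} → (x ⊕ y ⊕ fin 1) <∞ fin m →
                ∃₂ λ u v → x ≡ fin u × y ≡ fin v × u + v + 1 < m
⊕-⊕-1-<∞-fin⁻ {fin u} {fin v} (fin<fin u+v+1<m) = u , v , refl , refl , u+v+1<m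

min∞-≤ˡ : ∀ x y → min∞ x y ≤∞ x
min∞-≤ˡ (fin u) (fin v) = fin≤fin (m⊓n≤m u v)
min∞-≤ˡ (fin u) ∞       = fin≤fin ≤-refl
min∞-≤ˡ ∞       y       = y ≤∞∞

min∞-≤ʳ : ∀ x y → min∞ x y ≤∞ y
min∞-≤ʳ (fin u) (fin v) = fin≤fin (m⊓n≤n u v)
min∞-≤ʳ (fin u) ∞       = fin u ≤∞∞
min∞-≤ʳ ∞       (fin v) = fin≤fin ≤-refl
min∞-≤ʳ ∞       ∞       = ∞ ≤∞∞

max∞-<∞ : ∀ {x y k} → x <∞ fin k → y <∞ fin k → max∞ x y <∞ fin k
max∞-<∞ (fin<fin x<k) (fin<fin y<k) = fin<fin (⊔-lub x<k y<k)

max∞-fin⁻ : ∀ {x y k} → max∞ x y ≡ fin k → ∃₂ λ u v → x ≡ fin u × y ≡ fin v × u ⊔ v ≡ k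
max∞-fin⁻ {fin u} {fin v} refl = u , v , refl , refl , refl

_<∞?_ : Decidable _<∞_
fin m <∞? fin n = map′ fin<fin (λ { (fin<fin m<n) → m<n }) (m <? n)
fin m <∞? ∞     = yes fin<∞
∞     <∞? _     = no λ ()

module _ {A : Set} where

  head-∈ : ∀ xs {x : A} → head xs ≡ just x → x ∈ xs
  head-∈ (_ ∷ _) refl = here refl

  head-++⁺ : ∀ xs {x : A} ys → head xs ≡ just x → head (xs ++ ys) ≡ just x
  head-++⁺ (_ ∷ _) _ eq = eq

  head-++-∷ : ∀ xs {x : A} ys zs → head (xs ++ x ∷ ys) ≡ head (xs ++ x ∷ zs)
  head-++-∷ []      _ _ = refl
  head-++-∷ (_ ∷ _) _ _ = refl

  last-++-∷ : ∀ xs {x : A} ys → last (xs ++ x ∷ ys) ≡ last (x ∷ ys)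
  last-++-∷ []           _  = refl
  last-++-∷ (_ ∷ [])     _  = refl
  last-++-∷ (_ ∷ y ∷ xs) ys = last-++-∷ (y ∷ xs) ys

  last-∷ʳ : ∀ xs {x : A} → last (xs ∷ʳ x) ≡ just x
  last-∷ʳ xs = last-++-∷ xs []

  last-∈ : ∀ xs {x : A} → last xs ≡ just x → x ∈ xs
  last-∈ (_ ∷ [])     refl = here refl
  last-∈ (_ ∷ y ∷ xs) eq   = there (last-∈ (y ∷ xs) eq)

  length-∷ʳ : ∀ xs {x : A} → length (xs ∷ʳ x) ≡ suc (length xs)
  length-∷ʳ []       = refl
  length-∷ʳ (_ ∷ xs) = cong suc (length-∷ʳ xs)

  length-∷ʳ-∸1 : ∀ xs {x y : A} → head xs ≡ just x → length (xs ∷ʳ y) ∸ 1 ≡ suc (length xs ∸ 1)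
  length-∷ʳ-∸1 (_ ∷ xs) _ = length-∷ʳ xs

  unique-++⁻ˡ : ∀ xs {ys : List A} → Unique (xs ++ ys) → Unique xs
  unique-++⁻ˡ []       _           = []
  unique-++⁻ˡ (_ ∷ xs) (x∉ ∷ uniq) = Allₚ.++⁻ˡ xs x∉ ∷ unique-++⁻ˡ xs uniq

  unique-∉-suffix : ∀ pre {x : A} ys → Unique (pre ++ x ∷ ys) → x ∉ ys
  unique-∉-suffix []        _  uniq       = Uniqueₚ.Unique[x∷xs]⇒x∉xs uniq
  unique-∉-suffix (_ ∷ pre) ys (_ ∷ uniq) = unique-∉-suffix pre ys uniq

  unique-last : ∀ pre {x : A} ys → Unique (pre ++ x ∷ ys) → last (pre ++ x ∷ ys) ≡ just x → ys ≡ []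
  unique-last _   []       _    _   = refl
  unique-last pre (y ∷ ys) uniq end =
    ⊥-elim (unique-∉-suffix pre (y ∷ ys) uniq
             (last-∈ (y ∷ ys) (trans (sym (last-++-∷ pre (y ∷ ys))) end)))

  unique-loop : ∀ xs {x : A} → Unique xs → head xs ≡ just x → last xs ≡ just x → length xs ≡ 1
  unique-loop (_ ∷ ys) uniq refl end = cong (suc ∘ length) (unique-last [] ys uniq end)

  module _ {R : A → A → Set} where

    linked-++⁻ˡ : ∀ xs {ys} → Linked R (xs ++ ys) → Linked R xs
    linked-++⁻ˡ []           _        = []
    linked-++⁻ˡ (_ ∷ [])     _        = [-]
    linked-++⁻ˡ (_ ∷ y ∷ xs) (r ∷ rs) = r ∷ linked-++⁻ˡ (y ∷ xs) rs

    linked-infix : ∀ pre {x y ys} → Linked R (pre ++ x ∷ y ∷ ys) → R x y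
    linked-infix []        (r ∷ _) = r
    linked-infix (_ ∷ pre) rs      = linked-infix pre (Linked.tail rs)

  LastCounterexample : (A → Set) → List A → Set
  LastCounterexample Q xs = ∃₂ λ pre u → ∃ λ suf → xs ≡ pre ++ u ∷ suf × ¬ Q u × All Q suf

  ¬¬-all⊎last-counterexample : ∀ (Q : A → Set) xs → ¬ ¬ (All Q xs ⊎ LastCounterexample Q xs)
  ¬¬-all⊎last-counterexample Q []       = pure (inj₁ [])
  ¬¬-all⊎last-counterexample Q (x ∷ xs) = ¬¬-all⊎last-counterexample Q xs >>= λ where
    (inj₂ (pre , u , suf , xs≡ , ¬Qu , Q-suf)) →
      pure (inj₂ (x ∷ pre , u , suf , cong (x ∷_) xs≡ , ¬Qu , Q-suf))
    (inj₁ Q-xs) → ¬¬-excluded-middle >>= λ where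
      (yes Qx) → pure (inj₁ (Qx ∷ Q-xs))
      (no ¬Qx) → pure (inj₂ ([] , x , xs , refl , ¬Qx , Q-xs))

module AlternatingPaths {n} (G : SimpleGraph n) (M : Matching G) (d : Parity → Setup.V⁺ G M → ℕ∞) where
  open Setup G M
  open WithDist d
  open ≡-Reasoning

  Adj⁺-sym : ∀ {x y} → Adj⁺ x y → Adj⁺ y x
  Adj⁺-sym (f-w u) = w-f u
  Adj⁺-sym (w-f u) = f-w u
  Adj⁺-sym (w-o u) = o-w u
  Adj⁺-sym (o-w u) = w-o u
  Adj⁺-sym (o-o a) = o-o (SimpleGraph.sym G a)

  isMate≡true⇔ : ∀ a b → isMate a b ≡ true ⇔ Matching.mate M a ≡ just b
  isMate≡true⇔ a b with Matching.mate M a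
  ... | nothing = mk⇔ (λ ()) (λ ())
  ... | just c with c ≟F b
  ...   | yes refl = mk⇔ (λ _ → refl) (λ _ → refl)
  ...   | no c≢b   = mk⇔ (λ ()) (λ e → ⊥-elim (c≢b (just-injective e)))

  isMate-sym : ∀ a b → isMate a b ≡ isMate b a
  isMate-sym a b = ⇔→≡ (mk⇔ (flipped a b) (flipped b a))
    where
    open Equivalence
    flipped : ∀ a b → isMate a b ≡ true → isMate b a ≡ true
    flipped a b = from (isMate≡true⇔ b a) ∘ Matching.mate-sym M ∘ to (isMate≡true⇔ a b)

  isM⁺-sym : ∀ x y → isM⁺ x y ≡ isM⁺ y x
  isM⁺-sym f     f     = refl
  isM⁺-sym f     (w _) = refl
  isM⁺-sym f     (o _) = refl
  isM⁺-sym (w _) f     = refl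
  isM⁺-sym (w _) (w _) = refl
  isM⁺-sym (w _) (o _) = refl
  isM⁺-sym (o _) f     = refl
  isM⁺-sym (o _) (w _) = refl
  isM⁺-sym (o a) (o b) = isMate-sym a b

  ρ≡parityᵇ : ∀ x y → ρ x y ≡ parityᵇ (isM⁺ x y)
  ρ≡parityᵇ x y with isM⁺ x y
  ... | true  = refl
  ... | false = refl

  ρ-sym : ∀ x y → ρ x y ≡ ρ y x
  ρ-sym x y = begin
    ρ x y                ≡⟨ ρ≡parityᵇ x y ⟩
    parityᵇ (isM⁺ x y)   ≡⟨ cong parityᵇ (isM⁺-sym x y) ⟩
    parityᵇ (isM⁺ y x)   ≡⟨ ρ≡parityᵇ y x ⟨
    ρ y x                ∎

  alternating-tail : ∀ {x xs} → Alternating (x ∷ xs) → Alternating xs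
  alternating-tail [-]           = []
  alternating-tail [-,-]         = [-]
  alternating-tail (step _ _ al) = al

  alternating-ρ : ∀ {x y z zs} → Alternating (x ∷ y ∷ z ∷ zs) → ρ y z ≡ opposite (ρ x y)
  alternating-ρ {x} {y} {z} (step p q _) = begin
    ρ y z                          ≡⟨ ρ≡parityᵇ y z ⟩
    parityᵇ (isM⁺ y z)             ≡⟨ alternation⇒opposite p q ⟩
    opposite (parityᵇ (isM⁺ x y))  ≡⟨ cong opposite (ρ≡parityᵇ x y) ⟨
    opposite (ρ x y)               ∎

  alternating-∷ : ∀ {x y z zs} → ρ y z ≡ opposite (ρ x y) →
                  Alternating (y ∷ z ∷ zs) → Alternating (x ∷ y ∷ z ∷ zs)
  alternating-∷ {x} {y} {z} ρyz = step p q
    where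
    p,q = opposite⇒alternation (begin
      parityᵇ (isM⁺ y z)             ≡⟨ ρ≡parityᵇ y z ⟨
      ρ y z                          ≡⟨ ρyz ⟩
      opposite (ρ x y)               ≡⟨ cong opposite (ρ≡parityᵇ x y) ⟩
      opposite (parityᵇ (isM⁺ x y))  ∎)
    p = proj₁ p,q
    q = proj₂ p,q

  alternating-++⁻ˡ : ∀ xs {ys} → Alternating (xs ++ ys) → Alternating xs
  alternating-++⁻ˡ []               _             = []
  alternating-++⁻ˡ (_ ∷ [])         _             = [-]
  alternating-++⁻ˡ (_ ∷ _ ∷ [])     _             = [-,-]
  alternating-++⁻ˡ (_ ∷ y ∷ z ∷ xs) (step p q al) = step p q (alternating-++⁻ˡ (y ∷ z ∷ xs) al)

  alternating-∷ʳ : ∀ xs {s} → Alternating xs →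
                   (∀ pre {u r} → xs ≡ pre ++ u ∷ r ∷ [] → ρ r s ≡ opposite (ρ u r)) →
                   Alternating (xs ∷ʳ s)
  alternating-∷ʳ []               _             _         = [-]
  alternating-∷ʳ (_ ∷ [])         _             _         = [-,-]
  alternating-∷ʳ (_ ∷ _ ∷ [])     _             last-edge = alternating-∷ (last-edge [] refl) [-,-]
  alternating-∷ʳ (x ∷ y ∷ z ∷ xs) (step p q al) last-edge =
    step p q (alternating-∷ʳ (y ∷ z ∷ xs) al (λ pre eq → last-edge (x ∷ pre) (cong (x ∷_) eq)))

  alternating-infix : ∀ pre {u x y ys} → Alternating (pre ++ u ∷ x ∷ y ∷ ys) →
                      ρ x y ≡ opposite (ρ u x)
  alternating-infix []        al = alternating-ρ al
  alternating-infix (_ ∷ pre) al = alternating-infix pre (alternating-tail al)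

  alternating-ρ-from-f : ∀ {pre} → Reverse pre → ∀ {u x ys} → head (pre ++ u ∷ x ∷ ys) ≡ just f →
                         Alternating (pre ++ u ∷ x ∷ ys) → ρ u x ≡ parityOf (length pre)
  alternating-ρ-from-f []                 refl  _  = refl
  alternating-ρ-from-f (pre ∶ view ∶ʳ p) {u} {x} {ys} start al = begin
    ρ u x                             ≡⟨ alternating-infix pre al′ ⟩
    opposite (ρ p u)                  ≡⟨ cong opposite (alternating-ρ-from-f view start′ al′) ⟩
    opposite (parityOf (length pre))  ≡⟨ parityOf-suc (length pre) ⟨
    parityOf (suc (length pre))       ≡⟨ cong parityOf (length-∷ʳ pre) ⟨
    parityOf (length (pre ∷ʳ p))      ∎
    where
    al′ : Alternating (pre ++ p ∷ u ∷ x ∷ ys)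
    al′ = subst Alternating (∷ʳ-++ pre p (u ∷ x ∷ ys)) al
    start′ : head (pre ++ p ∷ u ∷ x ∷ ys) ≡ just f
    start′ = subst (λ xs → head xs ≡ just f) (∷ʳ-++ pre p (u ∷ x ∷ ys)) start

  len-at : ∀ {v} (p : AltPath v) {pre u ys} → verts p ≡ pre ++ u ∷ ys → len p ≡ length pre + length ys
  len-at p {pre} {u} {ys} eq = begin
    len p                       ≡⟨ cong (λ xs → length xs ∸ 1) eq ⟩
    length (pre ++ u ∷ ys) ∸ 1  ≡⟨ cong (_∸ 1) (length-++-sucʳ pre u ys) ⟩
    length (pre ++ ys)          ≡⟨ length-++ pre ⟩
    length pre + length ys      ∎

  adj-at : ∀ {v} (p : AltPath v) {pre u x ys} → verts p ≡ pre ++ u ∷ x ∷ ys → Adj⁺ u x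
  adj-at p {pre} eq = linked-infix pre (subst (Linked Adj⁺) eq (linked p))

  ρ-at : ∀ {v} (p : AltPath v) {pre u x ys} → verts p ≡ pre ++ u ∷ x ∷ ys →
         ρ u x ≡ parityOf (length pre)
  ρ-at p {pre} eq = alternating-ρ-from-f (reverseView pre)
    (subst (λ xs → head xs ≡ just f) eq (start p)) (subst Alternating eq (alt p))

  ρ-last : ∀ {v} (p : AltPath v) {pre u} → verts p ≡ pre ++ u ∷ v ∷ [] →
           opposite (ρ u v) ≡ parityOf (len p)
  ρ-last p {pre} {u} eq = begin
    opposite (ρ u _)                  ≡⟨ cong opposite (ρ-at p eq) ⟩
    opposite (parityOf (length pre))  ≡⟨ parityOf-suc (length pre) ⟨
    parityOf (suc (length pre))       ≡⟨ cong parityOf (trans (+-comm 1 (length pre)) (sym (len-at p eq))) ⟩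
    parityOf (len p)                  ∎

  at-end : ∀ {v} (p : AltPath v) {pre ys} → verts p ≡ pre ++ v ∷ ys → ys ≡ []
  at-end p {pre} {ys} eq =
    unique-last pre ys (subst Unique eq (simple p)) (subst (λ xs → last xs ≡ just _) eq (end p))

  last-vertex : ∀ {v} (p : AltPath v) {pre x} → verts p ≡ pre ++ x ∷ [] → x ≡ v
  last-vertex p {pre} eq = just-injective (trans (sym (trans (cong last eq) (last-∷ʳ pre))) (end p))

  prefix : ∀ {v} (p : AltPath v) {pre u ys} → verts p ≡ pre ++ u ∷ ys → AltPath u
  prefix p {pre} {u} {ys} eq = record
    { verts  = pre ∷ʳ u
    ; start  = trans (head-++-∷ pre [] ys) (subst (λ xs → head xs ≡ just f) eq (start p))
    ; end    = last-∷ʳ pre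
    ; linked = linked-++⁻ˡ (pre ∷ʳ u) (subst (Linked Adj⁺) split (linked p))
    ; simple = unique-++⁻ˡ (pre ∷ʳ u) (subst Unique split (simple p))
    ; alt    = alternating-++⁻ˡ (pre ∷ʳ u) (subst Alternating split (alt p))
    }
    where
    split : verts p ≡ (pre ∷ʳ u) ++ ys
    split = trans eq (sym (∷ʳ-++ pre u ys))

  len-prefix : ∀ {v} (p : AltPath v) {pre u ys} (eq : verts p ≡ pre ++ u ∷ ys) →
               len (prefix p eq) ≡ length pre
  len-prefix p {pre} _ = cong (_∸ 1) (length-∷ʳ pre)

  prefix-to : ∀ {v u} (p : AltPath v) → u ∈ verts p → ∃ λ (q : AltPath u) → len q ≤ len p
  prefix-to p u∈p with pre , ys , eq ← ∈-∃++ u∈p =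
    prefix p eq , subst₂ _≤_ (sym (len-prefix p eq)) (sym (len-at p eq)) (m≤m+n (length pre) (length ys))

  extend : ∀ {r s} (p : AltPath r) → s ∉ verts p → Adj⁺ r s → ρ r s ≡ parityOf (len p) → AltPath s
  extend {r} {s} p s∉p r~s ρrs = record
    { verts  = verts p ∷ʳ s
    ; start  = head-++⁺ (verts p) [ s ] (start p)
    ; end    = last-∷ʳ (verts p)
    ; linked = Linkedₚ.++⁺ (linked p) (subst (λ m → Connected Adj⁺ m (just s)) (sym (end p)) (just r~s)) [-]
    ; simple = Uniqueₚ.++⁺ (simple p) ([] ∷ []) (λ { (s∈p , here refl) → s∉p s∈p })
    ; alt    = alternating-∷ʳ (verts p) (alt p) last-edge
    }
    where
    last-edge : ∀ pre {u r′} → verts p ≡ pre ++ u ∷ r′ ∷ [] → ρ r′ s ≡ opposite (ρ u r′)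
    last-edge pre {u} eq with refl ← last-vertex p (trans eq (sym (∷ʳ-++ pre u _))) =
      trans ρrs (sym (ρ-last p eq))

  len-extend : ∀ {r s} (p : AltPath r) (s∉p : s ∉ verts p) (r~s : Adj⁺ r s)
               (ρrs : ρ r s ≡ parityOf (len p)) → len (extend p s∉p r~s ρrs) ≡ suc (len p)
  len-extend p _ _ _ = length-∷ʳ-∸1 (verts p) (start p)

module Distances {n} (G : SimpleGraph n) (M : Matching G) (d : Parity → Setup.V⁺ G M → ℕ∞)
                 (isD : Setup.IsDist G M d) where
  open Setup G M
  open WithDist d

  dist-path : ∀ {θ v m} → d θ v ≡ fin m → HasAltPath θ v m
  dist-path {θ} {v} eq with d θ v | isD θ v
  dist-path refl | fin _ | isMin path _ = path

  dist-parity : ∀ {θ v m} → d θ v ≡ fin m → parityOf m ≡ θ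
  dist-parity = proj₂ ∘ proj₂ ∘ dist-path

  dist-≤ : ∀ {θ v m} → HasAltPath θ v m → d θ v ≤∞ fin m
  dist-≤ {θ} {v} {m} path with d θ v | isD θ v
  ... | fin _ | isMin _ minimal = fin≤fin (minimal m path)
  ... | ∞     | none no-path    = ⊥-elim (no-path m path)

  distα-≤ : ∀ θ v → distα v ≤∞ d θ v
  distα-≤ odd  v = min∞-≤ˡ (d odd v) (d even v)
  distα-≤ even v = min∞-≤ʳ (d odd v) (d even v)

  distα-minimal : ∀ {v m} → distα v ≡ fin m → (p : AltPath v) → m ≤ len p
  distα-minimal {v} αv p =
    fin-≤∞⁻ (subst (_≤∞ fin (len p)) αv (≤∞-trans (distα-≤ _ v) (dist-≤ (p , refl , refl))))

  distα-smaller : ∀ θ {v a b} → d θ v ≡ fin a → d (opposite θ) v ≡ fin b → a ≤ b →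
                  distα v ≡ fin a
  distα-smaller odd  dθ dθ′ a≤b = trans (cong₂ min∞ dθ dθ′) (cong fin (m≤n⇒m⊓n≡m a≤b))
  distα-smaller even dθ dθ′ a≤b = trans (cong₂ min∞ dθ′ dθ) (cong fin (m≥n⇒m⊓n≡n a≤b))

  distβ-gap : ∀ {t k} → distβ t ≡ fin k →
              ∃₂ λ θ a → d θ t ≡ fin a × d (opposite θ) t ≡ fin k × distα t ≡ fin a × a < k
  distβ-gap {t} βt with max∞-fin⁻ βt
  ... | ℓₒ , ℓₑ , d-odd , d-even , refl with <-cmp ℓₒ ℓₑ
  ... | tri< ℓₒ<ℓₑ _ _ =
    odd , ℓₒ , d-odd , subst (λ m → d even t ≡ fin m) (sym (m≤n⇒m⊔n≡n (<⇒≤ ℓₒ<ℓₑ))) d-even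
    ,
    distα-smaller odd d-odd d-even (<⇒≤ ℓₒ<ℓₑ) , <-≤-trans ℓₒ<ℓₑ (m≤n⊔m ℓₒ ℓₑ)
  ... | tri> _ _ ℓₑ<ℓₒ =
    even , ℓₑ , d-even , subst (λ m → d odd t ≡ fin m) (sym (m≥n⇒m⊔n≡m (<⇒≤ ℓₑ<ℓₒ))) d-odd
    ,
    distα-smaller even d-even d-odd (<⇒≤ ℓₑ<ℓₒ) , <-≤-trans ℓₑ<ℓₒ (m≤m⊔n ℓₒ ℓₑ)
  ... | tri≈ _ ℓₒ≡ℓₑ _ = ⊥-elim (opposite-≢ even (begin
    odd               ≡⟨ dist-parity d-odd ⟨
    parityOf ℓₒ       ≡⟨ cong parityOf ℓₒ≡ℓₑ ⟩
    parityOf ℓₑ       ≡⟨ dist-parity d-even ⟩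
    even              ∎))
    where open ≡-Reasoning

module Subtrees {n} (G : SimpleGraph n) (M : Matching G) (d : Parity → Setup.V⁺ G M → ℕ∞)
                (isD : Setup.IsDist G M d) (T : Setup.WithDist.ABT G M d) where
  open Setup G M
  open WithDist d
  open InABT T
  open ABT T
  open AlternatingPaths G M d
  open Distances G M d isD

  Sub-f : ∀ {t} → Sub t f → t ≡ f
  Sub-f root           = refl
  Sub-f (down _ f≢f _) = ⊥-elim (f≢f refl)

  Sub-inversion : ∀ {t s} → Sub t s → s ≡ t ⊎ Sub t (parent s)
  Sub-inversion root          = inj₁ refl
  Sub-inversion (down _ _ ps) = inj₂ ps

  module _ {t : V⁺} {a : ℕ} (αt : distα t ≡ fin a) where

    subtree-longer    : ∀ {s} → Sub t s → (p : AltPath s) → a ≤ len p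
    descendant-longer : ∀ {s} → Sub t (parent s) → InTree s → s ≢ f → (p : AltPath s) → a < len p

    subtree-longer root                   p = distα-minimal αt p
    subtree-longer (down s-in s≢f ps∈) p = <⇒≤ (descendant-longer ps∈ s-in s≢f p)

    descendant-longer {s} ps∈ s-in s≢f p with parent-ok s s-in s≢f
    ... | W , αs , pre , eq = begin-strict
      a                  ≤⟨ subtree-longer ps∈ (prefix W eq) ⟩
      len (prefix W eq)  ≡⟨ len-prefix W eq ⟩
      length pre         <⟨ n<1+n (length pre) ⟩
      suc (length pre)   ≡⟨ trans (+-comm 1 (length pre)) (sym (len-at W eq)) ⟩
      len W              ≤⟨ distα-minimal αs p ⟩
      len p              ∎
      where open ≤-Reasoning

    subtree-strict : ∀ {s} → Sub t s → (p : AltPath s) → s ≡ t ⊎ a < len p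
    subtree-strict root                  _ = inj₁ refl
    subtree-strict (down s-in s≢f ps∈) p = inj₂ (descendant-longer ps∈ s-in s≢f p)

    inside-bound : ∀ {θ s u} → Sub t s → d θ s ≡ fin u → a ≤ u
    inside-bound s∈ ds with p , len≡u , _ ← dist-path ds = subst (a ≤_) len≡u (subtree-longer s∈ p)

    outside-bound : ∀ {r s v} → Adj⁺ r s → Sub t s → d (ρ r s) r ≡ fin v → ¬ ¬ (a ≤ suc v)
    outside-bound {r} {s} {v} r~s s∈ dr with p , len≡v , parity ← dist-path dr =
      ¬¬-map bound ¬¬-excluded-middle
      where
      bound : Dec (s ∈ verts p) → a ≤ suc v
      bound (yes s∈p) with q , q≤p ← prefix-to p s∈p =
        ≤-trans (subtree-longer s∈ q) (≤-trans q≤p (≤-trans (≤-reflexive len≡v) (n≤1+n v)))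
      bound (no s∉p) = subst (a ≤_) (trans (len-extend p s∉p r~s ρrs) (cong suc len≡v))
                                     (subtree-longer s∈ (extend p s∉p r~s ρrs))
        where
        ρrs : ρ r s ≡ parityOf (len p)
        ρrs = trans (sym parity) (cong parityOf (sym len≡v))

    incoming-hlevel : ∀ {y z k} → Incoming t y z → vlevel y z <∞ fin (a + k) → ¬ ¬ (hlevel y z <∞ fin k)
    incoming-hlevel {y} {z} {k} (y~z , _ , side) vl with u₁ , u₂ , dy , dz , sum< ← ⊕-⊕-1-<∞-fin⁻ vl =
      ¬¬-map hlevel< (endpoints side)
      where
      hlevel< : u₁ < k × u₂ < k → hlevel y z <∞ fin k
      hlevel< (u₁<k , u₂<k) =
        subst (_<∞ fin k) (sym (cong₂ max∞ dy dz)) (max∞-<∞ (fin<fin u₁<k) (fin<fin u₂<k))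
      endpoints : (Sub t y × ¬ Sub t z) ⊎ (¬ Sub t y × Sub t z) → ¬ ¬ (u₁ < k × u₂ < k)
      endpoints (inj₁ (y∈ , _)) =
        ¬¬-map (λ a≤1+u₂ → summands-< (inside-bound y∈ dy) a≤1+u₂ sum<)
               (outside-bound (Adj⁺-sym y~z) y∈ (subst (λ θ → d θ z ≡ fin u₂) (ρ-sym y z) dz))
      endpoints (inj₂ (_ , z∈)) =
        ¬¬-map (λ a≤1+u₁ → swap (summands-< (inside-bound z∈ dz) a≤1+u₁ sum<′))
               (outside-bound y~z z∈ dy)
        where
        sum<′ : u₂ + u₁ + 1 < a + k
        sum<′ = subst (λ m → m + 1 < a + k) (+-comm u₁ u₂) sum<

    module Crossing (θ : Parity) {k : ℕ} (dQ : d θ t ≡ fin a) (dP : d (opposite θ) t ≡ fin k)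
                    (a<k : a < k) where

      Q P : AltPath t
      Q = proj₁ (dist-path dQ)
      P = proj₁ (dist-path dP)

      len-Q : len Q ≡ a
      len-Q = proj₁ (proj₂ (dist-path dQ))

      len-P : len P ≡ k
      len-P = proj₁ (proj₂ (dist-path dP))

      parity-gap : parityOf a ≡ opposite (parityOf k)
      parity-gap = begin
        parityOf a                      ≡⟨ dist-parity dQ ⟩
        θ                               ≡⟨ opposite-involutive θ ⟨
        opposite (opposite θ)           ≡⟨ cong opposite (dist-parity dP) ⟨
        opposite (parityOf k)           ∎
        where open ≡-Reasoning

      t≢f : t ≢ f
      t≢f t≡f = <⇒≱ a<k (subst (_≤ a) (trans (sym (cong (_∸ 1) loop)) len-P) z≤n)
        where
        loop : length (verts P) ≡ 1
        loop = unique-loop (verts P) (simple P)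
                 (subst (λ v → head (verts P) ≡ just v) (sym t≡f) (start P)) (end P)

      P-avoids-parent-edge : ∀ pre → verts P ≢ pre ++ parent t ∷ t ∷ []
      P-avoids-parent-edge pre eq with parent-ok t (a , αt) t≢f
      ... | W , αW , _ , eqW = opposite-≢ (parityOf k) (begin
        opposite (parityOf k)          ≡⟨ parity-gap ⟨
        parityOf a                     ≡⟨ cong parityOf (fin-injective (trans (sym αt) αW)) ⟩
        parityOf (len W)               ≡⟨ ρ-last W eqW ⟨
        opposite (ρ (parent t) t)      ≡⟨ ρ-last P eq ⟩
        parityOf (len P)               ≡⟨ cong parityOf len-P ⟩
        parityOf k                     ∎)
        where open ≡-Reasoning

      subtree-∩-Q : ∀ {u} → u ∈ verts Q → Sub t u → u ≡ t
      subtree-∩-Q u∈Q u∈ with q , q≤Q ← prefix-to Q u∈Q with subtree-strict u∈ q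
      ... | inj₁ u≡t = u≡t
      ... | inj₂ a<q = ⊥-elim (<-irrefl refl (<-≤-trans a<q (≤-trans q≤Q (≤-reflexive len-Q))))

      -- Q followed by P walked backwards from t to x, the vertex at position j of P. It stays simple
      -- as it grows because its vertices in T(t) lie on P from x on (Q meets T(t) only at t), and
      -- alternating because a and k have opposite parities.
      record ReturnPath (j : ℕ) (x : V⁺) (suf : List V⁺) : Set where
        field
          path         : AltPath x
          len-sum      : len path + j ≡ a + k
          parity       : parityOf (len path) ≡ opposite (parityOf j)
          subtree-∩-path : ∀ {u} → u ∈ verts path → Sub t u → u ∈ x ∷ suf

      return-step : ∀ pre {x x′ suf} → verts P ≡ pre ++ x ∷ x′ ∷ suf → Sub t x →
                    ReturnPath (suc (length pre)) x′ suf → ReturnPath (length pre) x (x′ ∷ suf)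
      return-step pre {x} {x′} {suf} eq x∈ R′ = record
        { path         = extend R.path x∉R x′~x ρx′x
        ; len-sum      = trans (cong (_+ j) len-extended) (trans (sym (+-suc (len R.path) j)) R.len-sum)
        ; parity       = trans (cong parityOf len-extended)
                                 (trans (parityOf-suc (len R.path)) (cong opposite R-parity))
        ; subtree-∩-path = subtree-∩-extended
        }
        where
        module R = ReturnPath R′
        j = length pre
        x∉R : x ∉ verts R.path
        x∉R x∈R =
          unique-∉-suffix pre (x′ ∷ suf) (subst Unique eq (simple P)) (R.subtree-∩-path x∈R x∈)
        x′~x : Adj⁺ x′ x
        x′~x = Adj⁺-sym (adj-at P eq)
        R-parity : parityOf (len R.path) ≡ parityOf j
        R-parity = trans R.parity (opposite-parityOf-suc j)
        ρx′x : ρ x′ x ≡ parityOf (len R.path)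
        ρx′x = trans (ρ-sym x′ x) (trans (ρ-at P eq) (sym R-parity))
        len-extended : len (extend R.path x∉R x′~x ρx′x) ≡ suc (len R.path)
        len-extended = len-extend R.path x∉R x′~x ρx′x
        subtree-∩-extended : ∀ {u} → u ∈ verts R.path ∷ʳ x → Sub t u → u ∈ x ∷ x′ ∷ suf
        subtree-∩-extended u∈ u∈T with ∈-++⁻ (verts R.path) u∈
        ... | inj₁ u∈R         = there (R.subtree-∩-path u∈R u∈T)
        ... | inj₂ (here u≡x)  = here u≡x

      return-path : ∀ pre {x} suf → verts P ≡ pre ++ x ∷ suf → All (Sub t) (x ∷ suf) →
                    ReturnPath (length pre) x suf
      return-path pre [] eq _ with refl ← last-vertex P eq = record
        { path         = Q
        ; len-sum      = cong₂ _+_ len-Q pre≡k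
        ; parity       = trans (cong parityOf len-Q) (trans parity-gap (cong (opposite ∘ parityOf) (sym pre≡k)))
        ; subtree-∩-path = λ u∈Q u∈ → here (subtree-∩-Q u∈Q u∈)
        }
        where
        pre≡k : length pre ≡ k
        pre≡k = trans (sym (+-identityʳ (length pre))) (trans (sym (len-at P eq)) len-P)
      return-path pre {x} (x′ ∷ suf) eq (x∈ ∷ rest∈) = return-step pre eq x∈ R′
        where
        R′ : ReturnPath (suc (length pre)) x′ suf
        R′ = subst (λ j → ReturnPath j x′ suf) (length-∷ʳ pre)
                   (return-path (pre ∷ʳ x) suf (trans eq (sym (∷ʳ-++ pre x (x′ ∷ suf)))) rest∈)

      record LastEntry : Set where
        field
          {pre suf} : List V⁺
          {y z}     : V⁺
          split     : verts P ≡ pre ++ y ∷ z ∷ suf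
          y∉        : ¬ Sub t y
          z∷suf∈    : All (Sub t) (z ∷ suf)

      last-entry : ¬ ¬ LastEntry
      last-entry = ¬¬-map entry (¬¬-all⊎last-counterexample (Sub t) (verts P))
        where
        entry : All (Sub t) (verts P) ⊎ LastCounterexample (Sub t) (verts P) → LastEntry
        entry (inj₁ all∈) = ⊥-elim (t≢f (Sub-f (All.lookup all∈ (head-∈ (verts P) (start P)))))
        entry (inj₂ (_ , _ , [] , eq , y∉ , _)) = ⊥-elim (y∉ (subst (Sub t) (sym (last-vertex P eq)) root))
        entry (inj₂ (_ , _ , _ ∷ _ , eq , y∉ , z∷suf∈)) =
          record { split = eq ; y∉ = y∉ ; z∷suf∈ = z∷suf∈ }

      crossing-not-tree-edge : ∀ {pre y z suf} → verts P ≡ pre ++ y ∷ z ∷ suf → ¬ Sub t y → Sub t z →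
                               ¬ TreeEdge y z
      crossing-not-tree-edge _ y∉ z∈ (inj₁ (y-in , y≢f , refl)) = y∉ (down y-in y≢f z∈)
      crossing-not-tree-edge {pre} {suf = suf} eq y∉ z∈ (inj₂ (_ , _ , refl)) with Sub-inversion z∈
      ... | inj₂ pz∈ = y∉ pz∈
      ... | inj₁ refl with refl ← at-end P (trans eq (sym (∷ʳ-++ pre (parent t) (t ∷ suf)))) =
        P-avoids-parent-edge pre eq

      module CrossingEdge (entry : LastEntry) where
        open LastEntry entry public

        i : ℕ
        i = length pre

        z∈ : Sub t z
        z∈ = All.head z∷suf∈

        split′ : verts P ≡ (pre ∷ʳ y) ++ z ∷ suf
        split′ = trans split (sym (∷ʳ-++ pre y (z ∷ suf)))

        ρyz : ρ y z ≡ parityOf i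
        ρyz = ρ-at P split

        R : ReturnPath (suc i) z suf
        R = subst (λ j → ReturnPath j z suf) (length-∷ʳ pre) (return-path (pre ∷ʳ y) suf split′ z∷suf∈)

        open ReturnPath R using (path; len-sum; parity)

        i<k : i < k
        i<k = subst (i <_) (trans (sym (len-at P split)) len-P) (m<m+n i (s≤s z≤n))

        len-to-z : len (prefix P split′) ≡ suc i
        len-to-z = trans (len-prefix P split′) (length-∷ʳ pre)

        k≡1+i : z ≡ t → k ≡ suc i
        k≡1+i z≡t = begin
          k                                ≡⟨ len-P ⟨
          len P                            ≡⟨ len-at P split′ ⟩
          length (pre ∷ʳ y) + length suf   ≡⟨ cong₂ _+_ (length-∷ʳ pre) (cong length suf≡[]) ⟩
          suc i + 0                        ≡⟨ +-identityʳ (suc i) ⟩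
          suc i                            ∎
          where
          open ≡-Reasoning
          suf≡[] : suf ≡ []
          suf≡[] = at-end P (subst (λ v → verts P ≡ (pre ∷ʳ y) ++ v ∷ suf) z≡t split′)

        a≤i : a ≤ i
        a≤i with subtree-strict z∈ (prefix P split′)
        ... | inj₁ z≡t = ≤-pred (subst (a <_) (k≡1+i z≡t) a<k)
        ... | inj₂ a<  = ≤-pred (subst (a <_) len-to-z a<)

        d-y : d (ρ y z) y ≤∞ fin i
        d-y = dist-≤ (prefix P split , len-prefix P split , sym ρyz)

        d-z : d (ρ y z) z ≤∞ fin (len path)
        d-z = dist-≤ (path , refl , trans parity (trans (opposite-parityOf-suc i) (sym ρyz)))

        crossing-incoming : Incoming t y z
        crossing-incoming = adj-at P split , crossing-not-tree-edge split y∉ z∈ , inj₂ (y∉ , z∈)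

        crossing-vlevel : vlevel y z ≤∞ fin (a + k)
        crossing-vlevel = subst (λ m → vlevel y z ≤∞ fin m) i+ℓ+1≡a+k
                                (⊕-mono-≤∞ (⊕-mono-≤∞ d-y d-z) (fin≤fin ≤-refl))
          where
          open ≡-Reasoning
          i+ℓ+1≡a+k : i + len path + 1 ≡ a + k
          i+ℓ+1≡a+k = begin
            i + len path + 1      ≡⟨ +-comm (i + len path) 1 ⟩
            suc (i + len path)    ≡⟨ cong suc (+-comm i (len path)) ⟩
            suc (len path + i)    ≡⟨ +-suc (len path) i ⟨
            len path + suc i      ≡⟨ len-sum ⟩
            a + k                 ∎

        crossing-hlevel : hlevel y z <∞ fin k
        crossing-hlevel = max∞-<∞ (≤∞-<∞-trans d-y (fin<fin i<k))
                                  (≤∞-<∞-trans d-z (fin<fin (<-from-sum len-sum a≤i)))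

lemma6 : ∀ {n} (G : SimpleGraph n) (M : Matching G)
         (d : Parity → Setup.V⁺ G M → ℕ∞) → Setup.IsDist G M d →
         (T : Setup.WithDist.ABT G M d) →
         (t : Setup.V⁺ G M) → Setup.WithDist.InTree G M d t →
         (k : ℕ) → Setup.WithDist.distβ G M d t ≡ fin k →
         (y z : Setup.V⁺ G M) →
         Setup.WithDist.InABT.MinIncoming G M d T t y z →
         Setup.WithDist.hlevel G M d y z <∞ fin k
-- InTree t is implied by distβ t ≡ fin k.
lemma6 G M d isD T t _ k βt y* z* (incoming , minimal) with Distances.distβ-gap G M d isD βt
... | θ , a , dQ , dP , αt , a<k =
  decidable-stable (hlevel y* z* <∞? fin k) (last-entry >>= λ entry →
    let open CrossingEdge entry in
    case minimal y z crossing-incoming of λ where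
      (inj₁ v*<v)       → incoming-hlevel αt incoming (<∞-≤∞-trans v*<v crossing-vlevel)
      (inj₂ (_ , h*≤h)) → pure (≤∞-<∞-trans h*≤h crossing-hlevel))
  where
  open Setup.WithDist G M d
  open Subtrees G M d isD T
  open Crossing αt θ dQ dP a<k
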